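{- Let $n:\mathbb{Z}$ with $\mathsf{is\_prime}\,n$. Then $\overline{\exists}_{\lambda m.\,m=n}\,\mathsf{sieve}$ holds, i.e., there is $i$ such that the finite list $\mathsf{idl}\,\mathsf{sieve}\,i$ contains an element equal to $n$.
   Context: $\mathsf{colist}\,A$ is the coinductive type with constructors $\bot$ and $\mathsf{cocons}\,a\,l$, ordered coinductively by $\bot\sqsubseteq l$ and $\mathsf{cocons}\,a\,l_1\sqsubseteq\mathsf{cocons}\,a\,l_2$ if $l_1\sqsubseteq l_2$; order-equivalent streams are assumed equal (axiom). Lists $\mathsf{list}\,A$ are ordered by prefix. $\mathsf{idl}\,s\,0=\mathsf{nil}$, $\mathsf{idl}\,\bot\,(i+1)=\mathsf{nil}$, $\mathsf{idl}(\mathsf{cocons}\,a\,s)(i+1)=\mathsf{cons}\,a\,(\mathsf{idl}\,s\,i)$. For monotone $h:\mathsf{list}\,A\to C$, the continuous extension is $\overline h(s):=\sup_i h(\mathsf{idl}\,s\,i)$ (chosen supremum). $\mathsf{fold}\,z\,f$: $\mathsf{nil}\mapsto z$, $\mathsf{cons}\,a\,l\mapsto f\,a\,(\mathsf{fold}\,z\,f\,l)$. $\mathsf{filter}\,f:=\overline{\mathsf{fold}\,\bot\,(\lambda a\,l.\,\text{if }f\,a\text{ then }\mathsf{cocons}\,a\,l\text{ else }l)}:\mathsf{colist}\,A\to\mathsf{colist}\,A$ for $f:A\to\mathbb{B}$. $\mathsf{nats}\,n:=\mathsf{cocons}\,n\,(\mathsf{nats}(n+1))$ (corecursively, $n:\mathbb{Z}$).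 $\mathsf{sieve\_aux}:=\overline{\mathsf{fold}\,\bot\,(\lambda n\,l.\,\mathsf{cocons}\,n\,(\mathsf{filter}\,(\lambda m.\,m\bmod n\ne0)\,l))}$ and $\mathsf{sieve}:=\mathsf{sieve\_aux}(\mathsf{nats}\,2):\mathsf{colist}\,\mathbb{Z}$. $\mathsf{is\_prime}\,n :\iff 1<n\land\forall m,\ 1<m\to n\ne m\to n\bmod m\ne 0$. For $P:A\to\mathbb{P}$, $\overline{\exists}_P\,s :\iff \exists i,\ \mathsf{fold}\,\bot\,(\lambda a\,Q.\,P\,a\lor Q)\,(\mathsf{idl}\,s\,i)$ (the continuous extension into $\mathbb{P}$, whose suprema are existentials). -}

module Defs where

open import Level using (Level)
open import Data.Maybe using (Maybe; just; nothing)
open import Data.Unit using (⊤)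
open import Data.Nat using (ℕ; zero; suc)
open import Data.Integer using (ℤ; +_; _+_; _<_; ∣_∣)
open import Data.Integer.DivMod using (_%_)
open import Data.Bool using (Bool; true; false; if_then_else_; not)
open import Data.List using (List; []; _∷_)
open import Data.Product using (_×_; ∃)
open import Data.Sum using (_⊎_)
open import Data.Empty using (⊥)
open import Relation.Nullary using (¬_)
open import Relation.Nullary.Decidable using (⌊_⌋)
open import Relation.Binary.PropositionalEquality using (_≡_; _≢_; refl)
import Data.Integer.Properties as ℤP

-- Position i holds the i-th element, `nothing` marks ⊥.

record Colist (A : Set) : Set where
  field
    at     : ℕ → Maybe A
    closed : ∀ i → at i ≡ nothing → at (suc i) ≡ nothing

open Colist public

bot : {A : Set} → Colist A
bot .at _ = nothing
bot .closed _ _ = refl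

cocons : {A : Set} → A → Colist A → Colist A
cocons a s .at zero = just a
cocons a s .at (suc i) = s .at i
cocons a s .closed zero ()
cocons a s .closed (suc i) e = s .closed i e

tl : {A : Set} → Colist A → Colist A
tl s .at i = s .at (suc i)
tl s .closed i e = s .closed (suc i) e

-- Coinductive order:  ⊥ ⊑ l,   cocons a l₁ ⊑ cocons a l₂ if l₁ ⊑ l₂.
-- As the greatest fixed point of this (finitary) rule set, it is the
-- intersection of its finite unfoldings  ⊑[ k ]  (⊑[ 0 ] = everything).

⊑-step : {A : Set} → Maybe A → Maybe A → Set → Set
⊑-step nothing  _        R = ⊤
⊑-step (just a) nothing  R = ⊥
⊑-step (just a) (just b) R = (a ≡ b) × R

_⊑[_]_ : {A : Set} → Colist A → ℕ → Colist A → Set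
s ⊑[ zero ] t = ⊤
s ⊑[ suc k ] t = ⊑-step (s .at 0) (t .at 0) (tl s ⊑[ k ] tl t)

_⊑_ : {A : Set} → Colist A → Colist A → Set
s ⊑ t = ∀ k → s ⊑[ k ] t

ColistAntisymAxiom : Set₁
ColistAntisymAxiom = ∀ {A : Set} (s t : Colist A) → s ⊑ t → t ⊑ s → s ≡ t

idl : {A : Set} → Colist A → ℕ → List A
idl s zero = []
idl s (suc i) with s .at 0
... | nothing = []
... | just a  = a ∷ idl (tl s) i

fold : {a b : Level} {A : Set a} {B : Set b} → B → (A → B → B) → List A → B
fold z f [] = z
fold z f (a ∷ l) = f a (fold z f l)

IsChain : {A : Set} → (ℕ → Colist A) → Set
IsChain c = ∀ i → c i ⊑ c (suc i)

IsSupOperator : {A : Set} → ((ℕ → Colist A) → Colist A) → Set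
IsSupOperator {A} sup =
  ∀ (c : ℕ → Colist A) → IsChain c →
    (∀ i → c i ⊑ sup c) × (∀ (u : Colist A) → (∀ i → c i ⊑ u) → sup c ⊑ u)

-- Integer mod (Euclidean remainder, convention m mod 0 = m)

_mod_ : ℤ → ℤ → ℤ
m mod (+ zero) = m
m mod (+ suc k) = + (m % (+ suc k))
m mod (Data.Integer.-[1+ k ]) = + (m % Data.Integer.-[1+ k ])

modNonzero : ℤ → ℤ → Bool
modNonzero n m = not ⌊ (m mod n) ℤP.≟ + 0 ⌋

is-prime : ℤ → Set
is-prime n = (+ 1 < n) × (∀ m → + 1 < m → n ≢ m → n mod m ≢ + 0)

ExistsBar : {A : Set} → (A → Set) → Colist A → Set
ExistsBar P s = ∃ λ i → fold ⊥ (λ a Q → P a ⊎ Q) (idl s i)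

nats : ℤ → Colist ℤ
nats n .at i = just (n + + i)
nats n .closed i ()

module WithSup (sup : (ℕ → Colist ℤ) → Colist ℤ) where

  ext : (List ℤ → Colist ℤ) → Colist ℤ → Colist ℤ
  ext h s = sup (λ i → h (idl s i))

  filter : (ℤ → Bool) → Colist ℤ → Colist ℤ
  filter f = ext (fold bot (λ a l → if f a then cocons a l else l))

  sieve-aux : Colist ℤ → Colist ℤ
  sieve-aux = ext (fold bot (λ n l → cocons n (filter (modNonzero n) l)))

  sieve : Colist ℤ
  sieve = sieve-aux (nats (+ 2))

module Submission where

open import Defs
open import Data.Nat using (ℕ; zero; suc; z≤n; s≤s) renaming (_<_ to _<ℕ_)
open import Data.Nat.Properties using (<⇒≢; suc-injective)
open import Data.Integer using (ℤ; +_; -[1+_]; +<+; _<_)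
open import Data.Integer.Properties using (+-injective) renaming (_≟_ to _≟ℤ_)
open import Data.Maybe using (just; nothing)
open import Data.Unit using (tt)
open import Data.Empty using (⊥)
open import Data.Product using (∃-syntax; _×_; _,_; proj₁; proj₂)
open import Data.Sum using (_⊎_; inj₁; inj₂)
open import Data.Bool using (Bool; true; false; if_then_else_; not)
open import Data.List using (List; []; _∷_; _++_; [_])
open import Data.List.Relation.Binary.Prefix.Heterogeneous using (Prefix; []; _∷_)
open import Data.List.Relation.Unary.Any as Any using (Any; here; there)
open import Data.List.Relation.Unary.All as All using (All; []; _∷_)
open import Data.List.Membership.Propositional using (_∈_)
open import Data.List.Membership.Propositional.Properties using (∈-++⁺ʳ)
open import Relation.Nullary.Decidable using (dec-false; isYes≗does)
open import Relation.Binary.PropositionalEquality using (_≡_; _≢_; refl; sym; trans; cong)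

-- The prime p = 2 + k sits at position k of  nats 2,  and no earlier entry
-- 2 + j (j < k) divides it.  Each of the filters that the sieve stacks in
-- front of p therefore lets p through, so p occurs in the finite
-- approximation of the sieve built from the first k + 1 naturals, and a
-- chain element lies below its supremum.

_∈ᶜ_ : {A : Set} → A → Colist A → Set
x ∈ᶜ s = ∃[ j ] s .at j ≡ just x

PrefixMonotone : {A B : Set} → (List A → Colist B) → Set
PrefixMonotone h = ∀ {l l′} → Prefix _≡_ l l′ → h l ⊑ h l′

nothing-persists : {A : Set} (s : Colist A) (j : ℕ) → s .at 0 ≡ nothing → s .at j ≡ nothing
nothing-persists s zero    e = e
nothing-persists s (suc j) e = s .closed j (nothing-persists s j e)

bot⊑ : {A : Set} (t : Colist A) → bot ⊑ t
bot⊑ t zero    = tt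
bot⊑ t (suc k) = tt

cocons-mono : {A : Set} (a : A) {s t : Colist A} → s ⊑ t → cocons a s ⊑ cocons a t
cocons-mono a p zero    = tt
cocons-mono a p (suc k) = refl , p k

⊑[]-trans : {A : Set} (s t u : Colist A) (k : ℕ) → s ⊑[ k ] t → t ⊑[ k ] u → s ⊑[ k ] u
⊑[]-trans s t u zero    p q = tt
⊑[]-trans s t u (suc k) p q with s .at 0 | t .at 0 | u .at 0
... | nothing | _      | _       = tt
... | just a  | just b | just c  =
  trans (proj₁ p) (proj₁ q) , ⊑[]-trans (tl s) (tl t) (tl u) k (proj₂ p) (proj₂ q)

⊑-trans : {A : Set} {s t u : Colist A} → s ⊑ t → t ⊑ u → s ⊑ u
⊑-trans {s = s} {t} {u} p q k = ⊑[]-trans s t u k (p k) (q k)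

∈ᶜ-cocons : {A : Set} {x : A} (a : A) {s : Colist A} → x ∈ᶜ s → x ∈ᶜ cocons a s
∈ᶜ-cocons a (j , e) = suc j , e

∈ᶜ-mono : {A : Set} {x : A} {s t : Colist A} → s ⊑ t → x ∈ᶜ s → x ∈ᶜ t
∈ᶜ-mono {x = x} {s} {t} p (j , e) = j , at-mono s t j (p (suc j)) e
  where
  at-mono : (s t : Colist _) (j : ℕ) → s ⊑[ suc j ] t → s .at j ≡ just x → t .at j ≡ just x
  at-mono s t zero q e with s .at 0 | t .at 0
  at-mono s t zero (refl , _) refl | just a | just b = refl
  at-mono s t (suc j) q e with s .at 0 in e0 | t .at 0
  ... | nothing | _      with () ← trans (sym e) (nothing-persists s (suc j) e0)
  ... | just a  | just b = at-mono (tl s) (tl t) j (proj₂ q) e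

idl-prefix : {A : Set} (s : Colist A) (i : ℕ) → Prefix _≡_ (idl s i) (idl s (suc i))
idl-prefix s zero    = []
idl-prefix s (suc i) with s .at 0
... | nothing = []
... | just a  = refl ∷ idl-prefix (tl s) i

idl-mono : {A : Set} (s t : Colist A) (i : ℕ) → s ⊑[ i ] t → Prefix _≡_ (idl s i) (idl t i)
idl-mono s t zero    p = []
idl-mono s t (suc i) p with s .at 0 | t .at 0
... | nothing | _      = []
... | just a  | just b = proj₁ p ∷ idl-mono (tl s) (tl t) i (proj₂ p)

idl-snoc : {A : Set} (s : Colist A) (i : ℕ) {x : A} → s .at i ≡ just x → idl s (suc i) ≡ idl s i ++ [ x ]
idl-snoc s zero e with s .at 0
idl-snoc s zero refl | just a = refl
idl-snoc s (suc i) e with s .at 0 in e0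
... | nothing with () ← trans (sym e) (nothing-persists s (suc i) e0)
... | just a  = cong (a ∷_) (idl-snoc (tl s) i e)

∈-idl : {A : Set} (s : Colist A) (i : ℕ) {x : A} → s .at i ≡ just x → x ∈ idl s (suc i)
∈-idl s i {x} e rewrite idl-snoc s i e = ∈-++⁺ʳ (idl s i) (here refl)

∈-idl⁻ : {A : Set} (s : Colist A) (i : ℕ) {x : A} → x ∈ idl s i → ∃[ j ] j <ℕ i × s .at j ≡ just x
∈-idl⁻ s (suc i) m with s .at 0 in e0
∈-idl⁻ s (suc i) (here refl) | just a = 0 , s≤s z≤n , e0
∈-idl⁻ s (suc i) (there m)   | just a with ∈-idl⁻ (tl s) i m
... | j , j<i , e = suc j , s≤s j<i , e

Any⇒fold-⊎ : {A : Set} {P : A → Set} {l : List A} → Any P l → fold ⊥ (λ a Q → P a ⊎ Q) l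
Any⇒fold-⊎ (here p)  = inj₁ p
Any⇒fold-⊎ (there m) = inj₂ (Any⇒fold-⊎ m)

module Supremum {A : Set} (sup : (ℕ → Colist A) → Colist A) (isSup : IsSupOperator sup) where

  idl-chain : {h : List A → Colist A} → PrefixMonotone h → (s : Colist A) → IsChain (λ i → h (idl s i))
  idl-chain mono s i = mono (idl-prefix s i)

  extend : (List A → Colist A) → Colist A → Colist A
  extend h s = sup (λ i → h (idl s i))

  extend-mono : {h : List A → Colist A} → PrefixMonotone h →
                {s t : Colist A} → s ⊑ t → extend h s ⊑ extend h t
  extend-mono mono {s} {t} p =
    proj₂ (isSup _ (idl-chain mono s)) _
      (λ i → ⊑-trans (mono (idl-mono s t i (p i))) (proj₁ (isSup _ (idl-chain mono t)) i))

  ∈-extend : {h : List A → Colist A} → PrefixMonotone h →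
             (s : Colist A) (i : ℕ) {x : A} → x ∈ᶜ h (idl s i) → x ∈ᶜ extend h s
  ∈-extend mono s i = ∈ᶜ-mono (proj₁ (isSup _ (idl-chain mono s)) i)

prime⇒modNonzero : {n m : ℤ} → is-prime n → + 1 < m → n ≢ m → modNonzero m n ≡ true
prime⇒modNonzero {n} {m} (_ , noDivisor) 1<m n≢m =
  cong not (trans (isYes≗does n%m≟0) (dec-false n%m≟0 (noDivisor m 1<m n≢m)))
  where n%m≟0 = n mod m ≟ℤ + 0

module Sieve (sup : (ℕ → Colist ℤ) → Colist ℤ) (isSup : IsSupOperator sup) where
  open WithSup sup
  open Supremum sup isSup

  filterᴸ : (ℤ → Bool) → List ℤ → Colist ℤ
  filterᴸ f = fold bot (λ a l → if f a then cocons a l else l)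

  sieveᴸ : List ℤ → Colist ℤ
  sieveᴸ = fold bot (λ n l → cocons n (filter (modNonzero n) l))

  filterᴸ-mono : (f : ℤ → Bool) → PrefixMonotone (filterᴸ f)
  filterᴸ-mono f []               = bot⊑ _
  filterᴸ-mono f (_∷_ {a} refl p) with f a
  ... | true  = cocons-mono a (filterᴸ-mono f p)
  ... | false = filterᴸ-mono f p

  ∈-filterᴸ : (f : ℤ → Bool) {x : ℤ} {l : List ℤ} → f x ≡ true → x ∈ l → x ∈ᶜ filterᴸ f l
  ∈-filterᴸ f {l = a ∷ _} fx (here refl) rewrite fx = 0 , refl
  ∈-filterᴸ f {l = a ∷ _} fx (there m) with f a
  ... | true  = ∈ᶜ-cocons a (∈-filterᴸ f fx m)
  ... | false = ∈-filterᴸ f fx m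

  ∈-filter : (f : ℤ → Bool) {x : ℤ} {s : Colist ℤ} → f x ≡ true → x ∈ᶜ s → x ∈ᶜ filter f s
  ∈-filter f {s = s} fx (j , e) =
    ∈-extend (filterᴸ-mono f) s (suc j) (∈-filterᴸ f fx (∈-idl s j e))

  sieveᴸ-mono : PrefixMonotone sieveᴸ
  sieveᴸ-mono []               = bot⊑ _
  sieveᴸ-mono (_∷_ {a} refl p) =
    cocons-mono a (extend-mono {h = filterᴸ (modNonzero a)} (filterᴸ-mono (modNonzero a)) (sieveᴸ-mono p))

  ∈-sieveᴸ : {n : ℤ} {l : List ℤ} → All (λ a → modNonzero a n ≡ true) l → n ∈ᶜ sieveᴸ (l ++ [ n ])
  ∈-sieveᴸ []                   = 0 , refl
  ∈-sieveᴸ (_∷_ {a} coprime ps) = ∈ᶜ-cocons a (∈-filter (modNonzero a) coprime (∈-sieveᴸ ps))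

  ∈-sieve-aux : (s : Colist ℤ) (i : ℕ) {n : ℤ} → s .at i ≡ just n →
                All (λ a → modNonzero a n ≡ true) (idl s i) → n ∈ᶜ sieve-aux s
  ∈-sieve-aux s i {n} e coprime = ∈-extend sieveᴸ-mono s (suc i) n∈
    where
    n∈ : n ∈ᶜ sieveᴸ (idl s (suc i))
    n∈ rewrite idl-snoc s i e = ∈-sieveᴸ coprime

  prime-∈ᶜ-sieve : (n : ℤ) → is-prime n → n ∈ᶜ sieve
  prime-∈ᶜ-sieve (+ suc (suc k)) prime = ∈-sieve-aux (nats (+ 2)) k refl (All.tabulate earlier-coprime)
    where
    earlier-coprime : {a : ℤ} → a ∈ idl (nats (+ 2)) k → modNonzero a (+ suc (suc k)) ≡ true
    earlier-coprime a∈ with ∈-idl⁻ (nats (+ 2)) k a∈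
    ... | j , j<k , refl = prime⇒modNonzero prime (+<+ (s≤s (s≤s z≤n)))
                             (λ eq → <⇒≢ j<k (sym (suc-injective (suc-injective (+-injective eq)))))
  prime-∈ᶜ-sieve (+ 0)    (+<+ () , _)
  prime-∈ᶜ-sieve (+ 1)    (+<+ (s≤s ()) , _)
  prime-∈ᶜ-sieve -[1+ _ ] (() , _)

mainTheorem7 : (sup : (ℕ → Colist ℤ) → Colist ℤ) → IsSupOperator sup →
    ColistAntisymAxiom → (n : ℤ) → is-prime n →
    ExistsBar (λ m → m ≡ n) (WithSup.sieve sup)
mainTheorem7 sup isSup _ n prime with j , e ← Sieve.prime-∈ᶜ-sieve sup isSup n prime =
  suc j , Any⇒fold-⊎ (Any.map sym (∈-idl (WithSup.sieve sup) j e))
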